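{- Let $b,c,k\in\mathbb{N}$, and let $\mathcal{T}$ be a family of $c$-tassels, each with exactly $c$ paths, such that $|\mathcal{T}|\ge bkc^k$. For each $T\in\mathcal{T}$, let $x_T$ be the neck of $T$ and fix an enumeration $P^T_1,\dots,P^T_c$ of the paths of $T$. Let $K$ be a connected graph on at most $k$ vertices which is not a path, and assume that for every $T\in\mathcal{T}$ there is an isomorphism $f_T$ from $K$ to an induced subgraph of $T$. Then there exist $x'\in V(K)$ and $\mathcal{T}'\subseteq\mathcal{T}$ with $|\mathcal{T}'|=b$ such that: (a) for every $T\in\mathcal{T}'$, $f_T(x')=x_T$; and (b) for every component $L$ of $K\setminus\{x'\}$ there exists $i(L)\in\{1,\dots,c\}$ such that for every $T\in\mathcal{T}'$, $f_T(L)\subseteq P^T_{i(L)}$.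
   Context: A strand is a graph obtained from a path $P$ by adding a new vertex $x$ (the neck) with at least one neighbor in $P$; it is a $c$-strand if $x$ is non-adjacent to the first $c$ and last $c$ vertices of $P$. A $c$-tassel is a graph obtained from at least $c$ pairwise disjoint copies of a single $c$-strand $F$ by identifying their necks into a single vertex, the neck of the tassel; the paths of the tassel are the paths of these copies of $F$. -}

module Defs where

open import Data.Nat using (ℕ; suc; _≤_; _<_; _+_)
open import Data.Fin using (Fin; toℕ)
open import Data.Fin.Properties using () renaming (_≟_ to _≟ᶠ_)
open import Data.Nat.Properties using () renaming (_≟_ to _≟ⁿ_)
open import Data.Bool using (Bool; true; false; _∧_; _∨_)
open import Data.Maybe using (Maybe; just; nothing)
open import Data.Product using (Σ; ∃; _×_; _,_)
open import Data.Unit using (⊤)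
open import Relation.Nullary.Decidable using (⌊_⌋)
open import Relation.Binary.PropositionalEquality using (_≡_)

record SimpleGraph (n : ℕ) : Set where
  field
    adj    : Fin n → Fin n → Bool
    sym    : ∀ u v → adj u v ≡ adj v u
    irrefl : ∀ v → adj v v ≡ false
open SimpleGraph public

pathAdj : {m : ℕ} → Fin m → Fin m → Bool
pathAdj j j' = ⌊ suc (toℕ j) ≟ⁿ toℕ j' ⌋ ∨ ⌊ suc (toℕ j') ≟ⁿ toℕ j ⌋

IsPath : {n : ℕ} → SimpleGraph n → Set
IsPath {n} K = Σ (Fin n → Fin n) λ σ →
  (∀ u v → σ u ≡ σ v → u ≡ v) × (∀ u v → adj K u v ≡ pathAdj (σ u) (σ v))

data Reach {n : ℕ} (K : SimpleGraph n) (P : Fin n → Set) : Fin n → Fin n → Set where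
  here : ∀ {u} → P u → Reach K P u u
  step : ∀ {u v w} → P u → adj K u v ≡ true → Reach K P v w → Reach K P u w

Connected : {n : ℕ} → SimpleGraph n → Set
Connected K = ∀ u v → Reach K (λ _ → ⊤) u v

-- A c-strand: a path on vertices 0..len-1 plus a neck whose neighbourhood
-- on the path is given by nbr; the neck has at least one neighbour and is
-- non-adjacent to the first c and the last c vertices of the path.
record Strand (c : ℕ) : Set where
  field
    len    : ℕ
    nbr    : Fin len → Bool
    hasNbr : ∃ λ j → nbr j ≡ true
    away   : ∀ j → nbr j ≡ true → (c ≤ toℕ j) × (toℕ j + c < len)
open Strand public

-- A c-tassel with exactly c paths: c disjoint copies of a c-strand F with
-- their necks identified.  Vertex nothing is the neck, just (i , j) is the
-- j-th vertex of the path of the i-th copy.  The field enum is the fixed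
-- enumeration P_1 .. P_c of the paths: P_i is the path of copy (enum i).
record Tassel (c : ℕ) : Set where
  field
    strand   : Strand c
    enum     : Fin c → Fin c
    enum-inj : ∀ i i' → enum i ≡ enum i' → i ≡ i'
open Tassel public

TVertex : {c : ℕ} → Tassel c → Set
TVertex {c} T = Maybe (Fin c × Fin (len (strand T)))

tadj : {c : ℕ} (T : Tassel c) → TVertex T → TVertex T → Bool
tadj T nothing nothing = false
tadj T nothing (just (i , j)) = nbr (strand T) j
tadj T (just (i , j)) nothing = nbr (strand T) j
tadj T (just (i , j)) (just (i' , j')) = ⌊ i ≟ᶠ i' ⌋ ∧ pathAdj j j'

neck : {c : ℕ} (T : Tassel c) → TVertex T
neck T = nothing

OnPath : {c : ℕ} (T : Tassel c) → TVertex T → Fin c → Set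
OnPath T v i = ∃ λ j → v ≡ just (enum T i , j)

record InducedEmb {n c : ℕ} (K : SimpleGraph n) (T : Tassel c) : Set where
  field
    f     : Fin n → TVertex T
    f-inj : ∀ u v → f u ≡ f v → u ≡ v
    f-adj : ∀ u v → adj K u v ≡ tadj T (f u) (f v)
open InducedEmb public

-- An embedding of a connected graph K that misses the neck lies inside one
-- path of the tassel (an edge between two non-neck vertices never leaves its
-- path), so K would itself be a path.  Hence every f_T hits the neck at some
-- x_T, and every component of K − x_T is mapped into a single path P^T_i.
-- The pair (x_T, the path index of each vertex) takes at most k c^k values,
-- and pigeonhole over b k c^k tassels gives b of them sharing it.
module Submission where

open import Defs hiding (sym)
open import Data.Nat using (ℕ; _≤_; _*_; _^_)
open import Data.Fin using (Fin)
open import Data.Product using (Σ; _×_)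
open import Relation.Nullary using (¬_)
open import Relation.Binary.PropositionalEquality using (_≡_; _≢_)

open import Algebra.Properties.CommutativeMonoid.Sum as Sum using ()
open import Data.Bool using (Bool; true; if_then_else_; _∧_; _∨_)
open import Data.Fin using (zero; suc; toℕ; fromℕ<; combine; remQuot; funToFin; finToFun; punchOut)
open import Data.Fin.Properties
  using ( _≟_; any?; suc-injective; toℕ-fromℕ<; toℕ<n; toℕ-injective; injective⇒≤; punchOut-injective
        ; remQuot-combine; finToFun-funToFin)
open import Data.List using (allFin)
open import Data.List.Extrema.Nat using (argmin; f[argmin]≤f[xs])
open import Data.List.Membership.Propositional.Properties using (∈-allFin)
open import Data.List.Relation.Unary.All as All using ()
open import Data.Maybe using (Maybe; just; nothing)
open import Data.Nat as ℕ using (zero; suc; _+_; z≤n; s≤s; NonZero)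
open import Data.Nat.Properties as ℕ using ()
open import Data.Product using (∃; ∃-syntax; _,_; proj₁; proj₂)
open import Data.Unit using (⊤)
open import Function using (_∘_; id)
open import Function.Definitions using (Injective)
open import Relation.Nullary using (Dec; yes; no; does; contradiction)
open import Relation.Nullary.Decidable using (⌊_⌋; dec-true; isYes≗does)
open import Relation.Binary.PropositionalEquality
  using (refl; sym; trans; cong; cong₂; subst; subst₂; module ≡-Reasoning)

open Sum ℕ.+-0-commutativeMonoid using (sum; sum-syntax; ∑-comm; sum-cong-≗; sum-replicate-zero)

δ : ∀ {r} → Fin r → Fin r → ℕ
δ a y = if does (a ≟ y) then 1 else 0

count : ∀ {m r} → (Fin m → Fin r) → Fin r → ℕ
count {m} f y = ∑[ t < m ] δ (f t) y

∑-δ : ∀ {r} (a : Fin r) → ∑[ y < r ] δ a y ≡ 1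
∑-δ {suc r} zero    = cong suc (sum-replicate-zero r)
∑-δ {suc r} (suc a) = ∑-δ a

∑-one : ∀ m → ∑[ t < m ] 1 ≡ m
∑-one zero    = refl
∑-one (suc m) = cong suc (∑-one m)

∑-count : ∀ {m r} (f : Fin m → Fin r) → ∑[ y < r ] count f y ≡ m
∑-count {m} {r} f = begin
  ∑[ y < r ] ∑[ t < m ] δ (f t) y  ≡⟨ ∑-comm (λ t y → δ (f t) y) ⟨
  ∑[ t < m ] ∑[ y < r ] δ (f t) y  ≡⟨ sum-cong-≗ (∑-δ ∘ f) ⟩
  ∑[ t < m ] 1                     ≡⟨ ∑-one m ⟩
  m                                ∎
  where open ≡-Reasoning

∑-≤ : ∀ {r b} (q : Fin r → ℕ) → (∀ y → q y ≤ b) → ∑[ y < r ] q y ≤ r * b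
∑-≤ {zero}  q q≤b = z≤n
∑-≤ {suc r} q q≤b = ℕ.+-mono-≤ (q≤b zero) (∑-≤ (q ∘ suc) (q≤b ∘ suc))

∑-< : ∀ {r b} .{{_ : NonZero r}} (q : Fin r → ℕ) → (∀ y → q y ℕ.< b) → ∑[ y < r ] q y ℕ.< r * b
∑-< {suc r} q q<b = ℕ.+-mono-<-≤ (q<b zero) (∑-≤ (q ∘ suc) (ℕ.<⇒≤ ∘ q<b ∘ suc))

fibre-injection : ∀ {m r b} (f : Fin m → Fin r) (y : Fin r) → b ≤ count f y →
                  Σ (Fin b → Fin m) λ S → Injective _≡_ _≡_ S × (∀ s → f (S s) ≡ y)
fibre-injection {zero} f y z≤n = (λ ()) , (λ { {()} }) , λ ()
fibre-injection {suc m} f y b≤ = extend (f zero ≟ y) b≤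
  where
  extend : ∀ {b} (d : Dec (f zero ≡ y)) → b ≤ (if does d then 1 else 0) + count (f ∘ suc) y →
           Σ (Fin b → Fin (suc m)) λ S → Injective _≡_ _≡_ S × (∀ s → f (S s) ≡ y)
  extend (no _) b≤ with S , S-inj , fS≡y ← fibre-injection (f ∘ suc) y b≤ =
    suc ∘ S , S-inj ∘ suc-injective , fS≡y
  extend {zero} (yes _) _ = (λ ()) , (λ { {()} }) , λ ()
  extend {suc b} (yes f₀≡y) (s≤s b≤) with S , S-inj , fS≡y ← fibre-injection (f ∘ suc) y b≤ =
    S′ , S′-inj , fS′≡y
    where
    S′ : Fin (suc b) → Fin (suc m)
    S′ zero    = zero
    S′ (suc s) = suc (S s)
    S′-inj : Injective _≡_ _≡_ S′
    S′-inj {zero}  {zero}  _ = refl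
    S′-inj {suc s} {suc t} e = cong suc (S-inj (suc-injective e))
    fS′≡y : ∀ s → f (S′ s) ≡ y
    fS′≡y zero    = f₀≡y
    fS′≡y (suc s) = fS≡y s

pigeonhole : ∀ {m r} b (f : Fin m → Fin r) .{{_ : NonZero r}} → b * r ≤ m →
             ∃[ y ] Σ (Fin b → Fin m) λ S → Injective _≡_ _≡_ S × (∀ s → f (S s) ≡ y)
pigeonhole {m} {r} b f br≤m with any? (λ y → b ℕ.≤? count f y)
... | yes (y , b≤count) = y , fibre-injection f y b≤count
... | no none = contradiction m<br (ℕ.≤⇒≯ br≤m)
  where
  m<br : m ℕ.< b * r
  m<br = subst₂ ℕ._<_ (∑-count f) (ℕ.*-comm r b) (∑-< (count f) (λ y → ℕ.≰⇒> (none ∘ (y ,_))))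

pigeonhole-pair : ∀ {m n k c} b (x : Fin m → Fin n) (g : Fin m → Fin k → Fin c)
                  .{{_ : NonZero n}} .{{_ : NonZero c}} → b * (n * c ^ k) ≤ m →
                  Σ (Fin n) λ x′ → Σ (Fin k → Fin c) λ g′ → Σ (Fin b → Fin m) λ S →
                    Injective _≡_ _≡_ S × (∀ s → x (S s) ≡ x′) × (∀ s u → g (S s) u ≡ g′ u)
pigeonhole-pair {n = n} {k} {c} b x g {{n≢0}} bound
  with y , S , S-inj , key≡y ← pigeonhole b (λ t → combine (x t) (funToFin (g t)))
                                 {{ℕ.m*n≢0 n (c ^ k) {{n≢0}} {{ℕ.m^n≢0 c k}}}} bound =
  proj₁ (remQuot {n} (c ^ k) y) , finToFun (proj₂ (remQuot {n} (c ^ k) y)) , S , S-inj ,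
  (λ s → cong proj₁ (decode s)) ,
  (λ s u → trans (sym (finToFun-funToFin (g (S s)) u))
                  (cong (λ code → finToFun (proj₂ code) u) (decode s)))
  where
  decode : ∀ s → (x (S s) , funToFin (g (S s))) ≡ remQuot {n} (c ^ k) y
  decode s = trans (sym (remQuot-combine (x (S s)) _)) (cong (remQuot {n} (c ^ k)) (key≡y s))

module _ {n : ℕ} {K : SimpleGraph n} {P : Fin n → Set} where

  reach-start : ∀ {u v} → Reach K P u v → P u
  reach-start (here Pu)     = Pu
  reach-start (step Pu _ _) = Pu

  reach-end : ∀ {u v} → Reach K P u v → P v
  reach-end (here Pv)     = Pv
  reach-end (step _ _ uv) = reach-end uv

  reach-invariant : ∀ {A : Set} (h : Fin n → A) →
                    (∀ {u v} → P u → P v → adj K u v ≡ true → h u ≡ h v) →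
                    ∀ {u v} → Reach K P u v → h u ≡ h v
  reach-invariant h inv (here _)         = refl
  reach-invariant h inv (step Pu uw wv) = trans (inv Pu (reach-start wv) uw) (reach-invariant h inv wv)

  intermediate-value : (p : Fin n → ℕ) → (∀ {u v} → adj K u v ≡ true → p v ≤ suc (p u)) →
                       ∀ {u v a} → Reach K P u v → p u ≤ a → a ≤ p v → ∃ λ w → p w ≡ a
  intermediate-value p step≤1 {u} (here _) pu≤a a≤pv = u , ℕ.≤-antisym pu≤a a≤pv
  intermediate-value p step≤1 {u} {a = a} (step _ uw wv) pu≤a a≤pv with p u ℕ.≟ a
  ... | yes pu≡a = u , pu≡a
  ... | no pu≢a  = intermediate-value p step≤1 wv (ℕ.≤-trans (step≤1 uw) (ℕ.≤∧≢⇒< pu≤a pu≢a)) a≤pv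

consecutive : ℕ → ℕ → Bool
consecutive a b = ⌊ suc a ℕ.≟ b ⌋ ∨ ⌊ suc b ℕ.≟ a ⌋

consecutive⇒≤suc : ∀ a b → consecutive a b ≡ true → b ≤ suc a
consecutive⇒≤suc a b with suc a ℕ.≟ b | suc b ℕ.≟ a
... | yes refl | _        = λ _ → ℕ.≤-refl
... | no _     | yes refl = λ _ → ℕ.m≤n⇒m≤1+n (ℕ.n≤1+n b)
... | no _     | no _     = λ ()

consecutive-+ : ∀ o a b → consecutive (o + a) (o + b) ≡ consecutive a b
consecutive-+ o a b = cong₂ _∨_ (successor a b) (successor b a)
  where
  successor : ∀ a b → ⌊ suc (o + a) ℕ.≟ o + b ⌋ ≡ ⌊ suc a ℕ.≟ b ⌋
  successor a b with suc (o + a) ℕ.≟ o + b | suc a ℕ.≟ b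
  ... | yes _ | yes _  = refl
  ... | no _  | no _   = refl
  ... | yes e | no ¬e  = contradiction (ℕ.+-cancelˡ-≡ o _ _ (trans (ℕ.+-suc o a) e)) ¬e
  ... | no ¬e | yes e  = contradiction (trans (sym (ℕ.+-suc o a)) (cong (o +_) e)) ¬e

module _ {n : ℕ} {K : SimpleGraph (suc n)} (connected : Connected K)
         (p : Fin (suc n) → ℕ) (p-injective : Injective _≡_ _≡_ p)
         (adj≡consecutive : ∀ u v → adj K u v ≡ consecutive (p u) (p v)) where

  private
    u₀ : Fin (suc n)
    u₀ = argmin p zero (allFin (suc n))

    p₀≤p : ∀ u → p u₀ ≤ p u
    p₀≤p u = All.lookup (f[argmin]≤f[xs] {f = p} zero (allFin (suc n))) (∈-allFin u)

    step≤1 : ∀ {u v} → adj K u v ≡ true → p v ≤ suc (p u)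
    step≤1 {u} {v} uv = consecutive⇒≤suc (p u) (p v) (trans (sym (adj≡consecutive u v)) uv)

    -- A label ≥ p u₀ + suc n would force suc (suc n) distinct labels along a walk from u₀.
    p<p₀+1+n : ∀ u → p u ℕ.< p u₀ + suc n
    p<p₀+1+n u with p u ℕ.<? p u₀ + suc n
    ... | yes lt = lt
    ... | no ≮ = contradiction (injective⇒≤ hit-injective) ℕ.1+n≰n
      where
      labelled : ∀ (a : Fin (suc (suc n))) → ∃ λ w → p w ≡ p u₀ + toℕ a
      labelled a = intermediate-value p step≤1 (connected u₀ u) (ℕ.m≤m+n (p u₀) (toℕ a))
        (ℕ.≤-trans (ℕ.+-monoʳ-≤ (p u₀) (ℕ.s≤s⁻¹ (toℕ<n a))) (ℕ.≮⇒≥ ≮))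
      hit-injective : Injective _≡_ _≡_ (proj₁ ∘ labelled)
      hit-injective {a} {a′} e = toℕ-injective (ℕ.+-cancelˡ-≡ (p u₀) _ _
        (trans (sym (proj₂ (labelled a))) (trans (cong p e) (proj₂ (labelled a′)))))

    σ : Fin (suc n) → Fin (suc n)
    σ u = fromℕ< (ℕ.m<n+o⇒m∸n<o (p u) (p u₀) (p<p₀+1+n u))

    p≡p₀+σ : ∀ u → p u ≡ p u₀ + toℕ (σ u)
    p≡p₀+σ u = trans (sym (ℕ.m+[n∸m]≡n (p₀≤p u))) (cong (p u₀ +_) (sym (toℕ-fromℕ< _)))

  consecutive-labelling⇒IsPath : IsPath K
  consecutive-labelling⇒IsPath = σ , σ-injective , σ-adj
    where
    σ-injective : ∀ u v → σ u ≡ σ v → u ≡ v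
    σ-injective u v e =
      p-injective (trans (p≡p₀+σ u) (trans (cong ((p u₀ +_) ∘ toℕ) e) (sym (p≡p₀+σ v))))
    σ-adj : ∀ u v → adj K u v ≡ pathAdj (σ u) (σ v)
    σ-adj u v = begin
      adj K u v                                         ≡⟨ adj≡consecutive u v ⟩
      consecutive (p u) (p v)                           ≡⟨ cong₂ consecutive (p≡p₀+σ u) (p≡p₀+σ v) ⟩
      consecutive (p u₀ + toℕ (σ u)) (p u₀ + toℕ (σ v)) ≡⟨ consecutive-+ (p u₀) _ _ ⟩
      pathAdj (σ u) (σ v)                               ∎
      where open ≡-Reasoning

injective⇒surjective : ∀ {c} {g : Fin c → Fin c} → Injective _≡_ _≡_ g → ∀ y → ∃ λ x → g x ≡ y
injective⇒surjective {suc c} {g} g-injective y with any? (λ x → g x ≟ y)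
... | yes hit = hit
... | no miss = contradiction (injective⇒≤ {f = λ x → punchOut (missed x)} punchOut∘g-injective) ℕ.1+n≰n
  where
  missed : ∀ x → y ≢ g x
  missed x y≡gx = miss (x , sym y≡gx)
  punchOut∘g-injective : Injective _≡_ _≡_ (λ x → punchOut (missed x))
  punchOut∘g-injective = g-injective ∘ punchOut-injective (missed _) (missed _)

module _ {c : ℕ} (T : Tassel c) where

  enum-surjective : ∀ i → ∃ λ i′ → enum T i′ ≡ i
  enum-surjective = injective⇒surjective (λ {i} {i′} → enum-inj T i i′)

  -- d is a junk value for the neck, which lies on every path.
  pathIndex : Fin c → TVertex T → Fin c
  pathIndex d nothing        = d
  pathIndex d (just (i , _)) = proj₁ (enum-surjective i)

  onPath-pathIndex : ∀ d {v} → v ≢ neck T → OnPath T v (pathIndex d v)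
  onPath-pathIndex d {nothing}      v≢neck = contradiction refl v≢neck
  onPath-pathIndex d {just (i , j)} _      =
    j , cong (λ i′ → just (i′ , j)) (sym (proj₂ (enum-surjective i)))

  tadj⇒sameCopy : ∀ a a′ → tadj T (just a) (just a′) ≡ true → proj₁ a ≡ proj₁ a′
  tadj⇒sameCopy (i , _) (i′ , _) with i ≟ i′
  ... | yes i≡i′ = λ _ → i≡i′
  ... | no _     = λ ()

  pathIndex-adjacent : ∀ d {v w} → tadj T v w ≡ true → v ≢ neck T → w ≢ neck T →
                       pathIndex d v ≡ pathIndex d w
  pathIndex-adjacent d {nothing} _  v≢neck _ = contradiction refl v≢neck
  pathIndex-adjacent d {just _} {nothing} _ _ w≢neck = contradiction refl w≢neck
  pathIndex-adjacent d {just a} {just a′} vw _ _ = cong (proj₁ ∘ enum-surjective) (tadj⇒sameCopy a a′ vw)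

≢nothing⇒just : ∀ {A : Set} {x : Maybe A} → x ≢ nothing → ∃ λ a → x ≡ just a
≢nothing⇒just {x = just a}  _         = a , refl
≢nothing⇒just {x = nothing} x≢nothing = contradiction refl x≢nothing

≡nothing? : ∀ {A : Set} (x : Maybe A) → Dec (x ≡ nothing)
≡nothing? nothing  = yes refl
≡nothing? (just _) = no λ ()

avoidsNeck⇒IsPath : ∀ {n c} {K : SimpleGraph (suc n)} {T : Tassel c} → Connected K →
                    (e : InducedEmb K T) → (∀ u → f e u ≢ neck T) → IsPath K
avoidsNeck⇒IsPath {K = K} {T} connected e avoids =
  consecutive-labelling⇒IsPath connected position position-injective adj≡consecutive
  where
  body : ∀ u → ∃ λ a → f e u ≡ just a
  body u = ≢nothing⇒just (avoids u)
  copy : Fin _ → Fin _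
  copy u = proj₁ (proj₁ (body u))
  position : Fin _ → ℕ
  position u = toℕ (proj₂ (proj₁ (body u)))
  f≡body : ∀ u → f e u ≡ just (copy u , proj₂ (proj₁ (body u)))
  f≡body u = proj₂ (body u)

  sameCopy : ∀ u v → copy u ≡ copy v
  sameCopy u v = reach-invariant copy adjacent-sameCopy (connected u v)
    where
    adjacent-sameCopy : ∀ {u v} → ⊤ → ⊤ → adj K u v ≡ true → copy u ≡ copy v
    adjacent-sameCopy {u} {v} _ _ uv =
      tadj⇒sameCopy T (proj₁ (body u)) (proj₁ (body v))
        (subst₂ (λ x y → tadj T x y ≡ true) (f≡body u) (f≡body v) (trans (sym (f-adj e u v)) uv))

  position-injective : Injective _≡_ _≡_ position
  position-injective {u} {v} e′ = f-inj e u v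
    (trans (f≡body u)
    (trans (cong₂ (λ i j → just (i , j)) (sameCopy u v) (toℕ-injective e′))
           (sym (f≡body v))))

  adj≡consecutive : ∀ u v → adj K u v ≡ consecutive (position u) (position v)
  adj≡consecutive u v = begin
    adj K u v
      ≡⟨ f-adj e u v ⟩
    tadj T (f e u) (f e v)
      ≡⟨ cong₂ (tadj T) (f≡body u) (f≡body v) ⟩
    ⌊ copy u ≟ copy v ⌋ ∧ consecutive (position u) (position v)
      ≡⟨ cong (_∧ consecutive (position u) (position v)) ⌊sameCopy⌋ ⟩
    consecutive (position u) (position v)
      ∎
    where
    open ≡-Reasoning
    ⌊sameCopy⌋ : ⌊ copy u ≟ copy v ⌋ ≡ true
    ⌊sameCopy⌋ = trans (isYes≗does (copy u ≟ copy v)) (dec-true (copy u ≟ copy v) (sameCopy u v))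

neck-preimage : ∀ {n c} {K : SimpleGraph (suc n)} {T : Tassel c} → Connected K → ¬ IsPath K →
                (e : InducedEmb K T) → ∃ λ x → f e x ≡ neck T
neck-preimage connected notPath e with any? (λ u → ≡nothing? (f e u))
... | yes found = found
... | no none   = contradiction (avoidsNeck⇒IsPath connected e (λ u fu≡neck → none (u , fu≡neck))) notPath

component-onPath : ∀ {n c} {K : SimpleGraph n} {T : Tassel c} (e : InducedEmb K T) {x} →
                   f e x ≡ neck T → ∀ d {u v} → Reach K (_≢ x) u v →
                   OnPath T (f e v) (pathIndex T d (f e u))
component-onPath {K = K} {T} e {x} fx≡neck d {v = v} uv =
  subst (OnPath T (f e v)) (sym (reach-invariant (pathIndex T d ∘ f e) adjacent-samePath uv))
        (onPath-pathIndex T d (avoidsNeck (reach-end uv)))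
  where
  avoidsNeck : ∀ {u} → u ≢ x → f e u ≢ neck T
  avoidsNeck {u} u≢x fu≡neck = u≢x (f-inj e u x (trans fu≡neck (sym fx≡neck)))
  adjacent-samePath : ∀ {u w} → u ≢ x → w ≢ x → adj K u w ≡ true →
                      pathIndex T d (f e u) ≡ pathIndex T d (f e w)
  adjacent-samePath {u} {w} u≢x w≢x uw =
    pathIndex-adjacent T d (trans (sym (f-adj e u w)) uw) (avoidsNeck u≢x) (avoidsNeck w≢x)

lemma2p2 : (b c k : ℕ) → 1 ≤ c →
    (m : ℕ) (𝒯 : Fin m → Tassel c) → b * k * c ^ k ≤ m →
    (n : ℕ) (K : SimpleGraph n) → Connected K → ¬ IsPath K → n ≤ k →
    (emb : (t : Fin m) → InducedEmb K (𝒯 t)) →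
    Σ (Fin n) λ x' → Σ (Fin b → Fin m) λ S →
      (∀ s s' → S s ≡ S s' → s ≡ s')
      × (∀ s → f (emb (S s)) x' ≡ neck (𝒯 (S s)))
      × (∀ u → u ≢ x' → Σ (Fin c) λ i →
           ∀ s v → Reach K (λ w → w ≢ x') u v → OnPath (𝒯 (S s)) (f (emb (S s)) v) i)
lemma2p2 b (suc c) k _ m 𝒯 bkcᵏ≤m zero K _ notPath _ _ = contradiction (id , (λ _ _ → id) , λ ()) notPath
lemma2p2 b (suc c) k _ m 𝒯 bkcᵏ≤m (suc n) K connected notPath n≤k emb =
  let x′ , colour , S , S-injective , x∘S≡x′ , colouring∘S≡colour =
        pigeonhole-pair b (proj₁ ∘ neckAt) colouring bound
      neck-x′ : ∀ s → f (emb (S s)) x′ ≡ neck (𝒯 (S s))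
      neck-x′ s = subst (λ x → f (emb (S s)) x ≡ neck (𝒯 (S s))) (x∘S≡x′ s) (proj₂ (neckAt (S s)))
  in x′ , S , (λ _ _ → S-injective) , neck-x′ , λ u _ → colour u , λ s v uv →
       subst (OnPath (𝒯 (S s)) (f (emb (S s)) v)) (colouring∘S≡colour s u)
             (component-onPath (emb (S s)) (neck-x′ s) zero uv)
  where
  neckAt : ∀ t → ∃ λ x → f (emb t) x ≡ neck (𝒯 t)
  neckAt t = neck-preimage connected notPath (emb t)
  colouring : Fin m → Fin (suc n) → Fin (suc c)
  colouring t u = pathIndex (𝒯 t) zero (f (emb t) u)
  bound : b * (suc n * suc c ^ suc n) ≤ m
  bound = ℕ.≤-trans (ℕ.*-monoʳ-≤ b (ℕ.*-mono-≤ n≤k (ℕ.^-monoʳ-≤ (suc c) n≤k)))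
                    (subst (_≤ m) (ℕ.*-assoc b k _) bkcᵏ≤m)
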